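{- Let $\mathbb{O}$ be the octahedron graph, i.e., the graph formed by the $6$ vertices and $12$ edges of a regular octahedron (isomorphic to the complete tripartite graph $K_{2,2,2}$). Then $k(\mathbb{O})=2$.
   Context: All graphs are simple and undirected. The competition graph $C(D)$ of a digraph $D$ is the graph with vertex set $V(D)$ in which two distinct vertices $x,y$ are adjacent if and only if there is a vertex $v$ with $(x,v)$ and $(y,v)$ both arcs of $D$. The competition number $k(G)$ of a graph $G$ is the minimum integer $k\ge 0$ such that $G$ together with $k$ new isolated vertices is the competition graph of some acyclic digraph. -}

module Defs where

open import Data.Nat using (ℕ; _+_; _≤_; _%_)
open import Data.Fin using (Fin; toℕ; splitAt)
open import Data.Sum using (_⊎_; inj₁; inj₂)
open import Data.Product using (_×_; ∃-syntax)
open import Data.Empty using (⊥)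
open import Relation.Nullary using (¬_)
open import Relation.Binary.PropositionalEquality using (_≡_; _≢_)
open import Relation.Binary.Construct.Closure.Transitive using (TransClosure)
open import Function.Bundles using (_⇔_)

record Graph (n : ℕ) : Set₁ where
  field
    Adj   : Fin n → Fin n → Set
    sym   : ∀ {x y} → Adj x y → Adj y x
    irrefl : ∀ {x} → ¬ Adj x x

Digraph : ℕ → Set₁
Digraph m = Fin m → Fin m → Set

Acyclic : ∀ {m} → Digraph m → Set
Acyclic D = ∀ x → ¬ TransClosure D x x

AddIsolatedAdj : ∀ {n} → Graph n → (k : ℕ) → Fin (n + k) → Fin (n + k) → Set
AddIsolatedAdj {n} G k x y with splitAt n x | splitAt n y
... | inj₁ a | inj₁ b = Graph.Adj G a b
... | _      | _      = ⊥

IsCompetitionGraphOf : ∀ {m} → (Fin m → Fin m → Set) → Digraph m → Set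
IsCompetitionGraphOf H D =
  ∀ x y → x ≢ y → (H x y ⇔ (∃[ v ] (D x v × D y v)))

CompetitionRealizable : ∀ {n} → Graph n → ℕ → Set₁
CompetitionRealizable {n} G k =
  ∃[ D ] (Acyclic {n + k} D × IsCompetitionGraphOf (AddIsolatedAdj G k) D)

CompetitionNumberIs : ∀ {n} → Graph n → ℕ → Set₁
CompetitionNumberIs G c =
  CompetitionRealizable G c × (∀ k → CompetitionRealizable G k → c ≤ k)

-- Octahedron graph K_{2,2,2} on Fin 6: parts {0,3}, {1,4}, {2,5};
-- x ~ y iff they lie in different parts.
octAdj : Fin 6 → Fin 6 → Set
octAdj x y = toℕ x % 3 ≢ toℕ y % 3

octahedron : Graph 6
octahedron = record
  { Adj = octAdj
  ; sym = λ p q → p (Relation.Binary.PropositionalEquality.sym q)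
  ; irrefl = λ p → p Relation.Binary.PropositionalEquality.refl
  }

-- The lower bound: if at most one new vertex is added, every octahedron vertex u
-- still has an arc to an original vertex. Indeed u has two non-adjacent
-- neighbours y₁, y₂ (an antipodal pair); the common prey of u, y₁ and that of
-- u, y₂ cannot both be the single new vertex, since then y₁ and y₂ would compete.
-- So the six original vertices span a digraph without sinks, which in a finite
-- acyclic digraph is impossible.
--
-- The upper bound: the faces {0,1,2}, {2,3,4}, {0,4,5}, {1,3,5} partition the
-- edges of the octahedron, and they are made the in-neighbourhoods of the preys
-- 3, 5, 6, 7 respectively; all arcs then increase, so the digraph is acyclic.
module Submission where

open import Defs
open import Data.Bool using (Bool; true; false; T)
open import Data.Bool.Properties using (T?)
open import Data.Empty using (⊥-elim)
open import Data.Fin using (Fin; toℕ; splitAt; _↑ˡ_; _↑ʳ_; _<_)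
open import Data.Fin.Patterns
open import Data.Fin.Properties
  using (_≟_; _<?_; <-irrefl; <-trans; all?; any?; pigeonhole;
         splitAt-↑ˡ; splitAt⁻¹-↑ˡ; splitAt⁻¹-↑ʳ; ↑ˡ-injective)
open import Data.Nat as ℕ using (ℕ; zero; suc; _+_; _≤_; _<′_; <′-base; <′-step; s≤s; z≤n; _%_)
open import Data.Nat.Properties using (<⇒<′; n<1+n)
open import Data.Product using (_×_; _,_; ∃-syntax; proj₁; proj₂; uncurry)
open import Data.Sum using (_⊎_; inj₁; inj₂)
open import Function using (_∘_; id)
open import Function.Bundles using (_⇔_; mk⇔; Equivalence)
open import Relation.Binary.Construct.Closure.Transitive using (TransClosure; [_]; _∷_; _∷ʳ_)
open import Relation.Binary.PropositionalEquality using (_≡_; _≢_; refl; sym; subst)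
open import Relation.Nullary using (¬_; Dec; no; ¬?; _×-dec_; _→-dec_; map′; Irrelevant)
open import Relation.Nullary.Decidable using (from-yes)

private
  variable
    m n k : ℕ

increasing⇒acyclic : {D : Digraph m} → (∀ x y → D x y → x < y) → Acyclic D
increasing⇒acyclic {D = D} increasing x cycle = <-irrefl refl (increasing⁺ cycle)
  where
  increasing⁺ : ∀ {x y} → TransClosure D x y → x < y
  increasing⁺ [ x→y ]      = increasing _ _ x→y
  increasing⁺ (x→y ∷ y→⁺z) = <-trans (increasing _ _ x→y) (increasing⁺ y→⁺z)

acyclic-pullback : {D : Digraph m} (f : Fin n → Fin m) →
                   Acyclic D → Acyclic (λ u w → D (f u) (f w))
acyclic-pullback {D = D} f acyclic x = acyclic (f x) ∘ image
  where
  image : ∀ {u w} → TransClosure (λ u w → D (f u) (f w)) u w → TransClosure D (f u) (f w)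
  image [ u→w ]      = [ u→w ]
  image (u→v ∷ v→⁺w) = u→v ∷ image v→⁺w

module _ {R : Digraph (suc n)} (out : ∀ u → ∃[ w ] R u w) where
  private
    orbit : ℕ → Fin (suc n)
    orbit zero    = 0F
    orbit (suc i) = proj₁ (out (orbit i))

    walk : ∀ {i j} → i <′ j → TransClosure R (orbit i) (orbit j)
    walk <′-base     = [ proj₂ (out _) ]
    walk (<′-step p) = walk p ∷ʳ proj₂ (out _)

  sinkless⇒¬acyclic : ¬ Acyclic R
  sinkless⇒¬acyclic acyclic
    with i , j , i<j , orbitᵢ≡orbitⱼ ← pigeonhole (n<1+n (suc n)) (orbit ∘ toℕ)
    = acyclic (orbit (toℕ i))
        (subst (TransClosure R (orbit (toℕ i))) (sym orbitᵢ≡orbitⱼ) (walk (<⇒<′ i<j)))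

record InducedPathCentre (G : Graph n) (u : Fin n) : Set where
  constructor induced-path
  open Graph G
  field
    left right       : Fin n
    ends-distinct    : left ≢ right
    adj-left         : Adj u left
    adj-right        : Adj u right
    ends-nonadjacent : ¬ Adj left right

adjacent⇒distinct : (G : Graph n) {x y : Fin n} → Graph.Adj G x y → x ≢ y
adjacent⇒distinct G xy refl = Graph.irrefl G xy

addIsolatedAdj-↑ˡ : (G : Graph n) (k : ℕ) (a b : Fin n) →
                    AddIsolatedAdj G k (a ↑ˡ k) (b ↑ˡ k) ⇔ Graph.Adj G a b
addIsolatedAdj-↑ˡ {n} G k a b rewrite splitAt-↑ˡ n a k | splitAt-↑ˡ n b k = mk⇔ id id

original-or-new : (v : Fin (n + k)) → (∃[ a ] a ↑ˡ k ≡ v) ⊎ (∃[ b ] n ↑ʳ b ≡ v)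
original-or-new {n} v with splitAt n v in eq
... | inj₁ a = inj₁ (a , splitAt⁻¹-↑ˡ eq)
... | inj₂ b = inj₂ (b , splitAt⁻¹-↑ʳ eq)

module _ {G : Graph n} {D : Digraph (n + k)}
         (competition : IsCompetitionGraphOf (AddIsolatedAdj G k) D) where
  open Graph G

  adj⇔compete : ∀ {x y} → x ≢ y → Adj x y ⇔ (∃[ v ] (D (x ↑ˡ k) v × D (y ↑ˡ k) v))
  adj⇔compete {x} {y} x≢y =
    let lifted = competition (x ↑ˡ k) (y ↑ˡ k) (x≢y ∘ ↑ˡ-injective k x y)
        base   = addIsolatedAdj-↑ˡ G k x y
    in  mk⇔ (Equivalence.to lifted ∘ Equivalence.from base)
            (Equivalence.to base ∘ Equivalence.from lifted)

  adjacent⇒compete : ∀ {x y} → Adj x y → ∃[ v ] (D (x ↑ˡ k) v × D (y ↑ˡ k) v)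
  adjacent⇒compete xy = Equivalence.to (adj⇔compete (adjacent⇒distinct G xy)) xy

  centre-has-original-prey : Irrelevant (Fin k) → ∀ {u} → InducedPathCentre G u →
                             ∃[ w ] D (u ↑ˡ k) (w ↑ˡ k)
  centre-has-original-prey atMostOneNew (induced-path y₁ y₂ y₁≢y₂ uy₁ uy₂ y₁≁y₂)
    with v₁ , u→v₁ , y₁→v₁ ← adjacent⇒compete uy₁ | v₂ , u→v₂ , y₂→v₂ ← adjacent⇒compete uy₂
    with original-or-new {n} {k} v₁ | original-or-new {n} {k} v₂
  ... | inj₁ (a , refl) | _               = a , u→v₁
  ... | inj₂ _          | inj₁ (a , refl) = a , u→v₂
  ... | inj₂ (b₁ , refl) | inj₂ (b₂ , refl) rewrite atMostOneNew b₁ b₂ =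
    ⊥-elim (y₁≁y₂ (Equivalence.from (adj⇔compete y₁≢y₂) (_ , y₁→v₁ , y₂→v₂)))

unrealizable-with-≤1-new : (G : Graph (suc n)) → (∀ u → InducedPathCentre G u) →
                           Irrelevant (Fin k) → ¬ CompetitionRealizable G k
unrealizable-with-≤1-new {k = k} G centres atMostOneNew (D , acyclic , competition) =
  sinkless⇒¬acyclic (centre-has-original-prey competition atMostOneNew ∘ centres)
    (acyclic-pullback (_↑ˡ k) acyclic)

octahedron-centre : ∀ u → InducedPathCentre octahedron u
octahedron-centre 0F = induced-path 1F 4F (λ ()) (λ ()) (λ ()) (λ y₁≁y₂ → y₁≁y₂ refl)
octahedron-centre 1F = induced-path 2F 5F (λ ()) (λ ()) (λ ()) (λ y₁≁y₂ → y₁≁y₂ refl)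
octahedron-centre 2F = induced-path 0F 3F (λ ()) (λ ()) (λ ()) (λ y₁≁y₂ → y₁≁y₂ refl)
octahedron-centre 3F = induced-path 1F 4F (λ ()) (λ ()) (λ ()) (λ y₁≁y₂ → y₁≁y₂ refl)
octahedron-centre 4F = induced-path 2F 5F (λ ()) (λ ()) (λ ()) (λ y₁≁y₂ → y₁≁y₂ refl)
octahedron-centre 5F = induced-path 0F 3F (λ ()) (λ ()) (λ ()) (λ y₁≁y₂ → y₁≁y₂ refl)

_⇔-dec_ : {A B : Set} → Dec A → Dec B → Dec (A ⇔ B)
a? ⇔-dec b? = map′ (uncurry mk⇔) (λ a⇔b → Equivalence.to a⇔b , Equivalence.from a⇔b)
                   ((a? →-dec b?) ×-dec (b? →-dec a?))

isCompetitionGraphOf? : {H D : Fin m → Fin m → Set} →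
                        (∀ x y → Dec (H x y)) → (∀ x y → Dec (D x y)) →
                        Dec (IsCompetitionGraphOf H D)
isCompetitionGraphOf? H? D? =
  all? λ x → all? λ y → ¬? (x ≟ y) →-dec (H? x y ⇔-dec any? λ v → D? x v ×-dec D? y v)

addIsolatedAdj? : (G : Graph n) → (∀ a b → Dec (Graph.Adj G a b)) →
                  ∀ k x y → Dec (AddIsolatedAdj G k x y)
addIsolatedAdj? {n} G adj? k x y with splitAt n x | splitAt n y
... | inj₁ a | inj₁ b = adj? a b
... | inj₁ _ | inj₂ _ = no id
... | inj₂ _ | _      = no id

octAdj? : ∀ x y → Dec (octAdj x y)
octAdj? x y = ¬? (toℕ x % 3 ℕ.≟ toℕ y % 3)

octahedron-arc : Fin 8 → Fin 8 → Bool
octahedron-arc 0F 3F = true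
octahedron-arc 1F 3F = true
octahedron-arc 2F 3F = true
octahedron-arc 2F 5F = true
octahedron-arc 3F 5F = true
octahedron-arc 4F 5F = true
octahedron-arc 0F 6F = true
octahedron-arc 4F 6F = true
octahedron-arc 5F 6F = true
octahedron-arc 1F 7F = true
octahedron-arc 3F 7F = true
octahedron-arc 5F 7F = true
octahedron-arc _  _  = false

octahedron-digraph : Digraph 8
octahedron-digraph x y = T (octahedron-arc x y)

octahedron-realizable-2 : CompetitionRealizable octahedron 2
octahedron-realizable-2 =
  octahedron-digraph ,
  increasing⇒acyclic
    (from-yes (all? λ x → all? λ y → T? (octahedron-arc x y) →-dec x <? y)) ,
  from-yes (isCompetitionGraphOf? (addIsolatedAdj? octahedron octAdj? 2)
                                  (λ x y → T? (octahedron-arc x y)))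

theorem2p3 : CompetitionNumberIs octahedron 2
theorem2p3 = octahedron-realizable-2 , needs-two
  where
  octahedron-unrealizable : Irrelevant (Fin k) → ¬ CompetitionRealizable octahedron k
  octahedron-unrealizable = unrealizable-with-≤1-new octahedron octahedron-centre

  needs-two : ∀ k → CompetitionRealizable octahedron k → 2 ≤ k
  needs-two 0             = ⊥-elim ∘ octahedron-unrealizable λ ()
  needs-two 1             = ⊥-elim ∘ octahedron-unrealizable λ { 0F 0F → refl }
  needs-two (suc (suc k)) _ = s≤s (s≤s z≤n)
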